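{- Let $p\le q$ and let $(K_{p,q},\sigma)$ be a signed complete bipartite graph with bipartition $(U_p,V_q)$, $U_p=\{u_1,\dots,u_p\}$, $V_q=\{v_1,\dots,v_q\}$. Let $U_r\subseteq U_p$ and $V_s\subseteq V_q$ with $|U_r|=r\le p$, $|V_s|=s\le q$ be such that the induced signed subgraph on $U_r\cup V_s$ contains all positive edges of $(K_{p,q},\sigma)$, and such that $r+s$ is minimum among all vertex sets of this form with this property. Then the multiplicity $m(0)$ of the eigenvalue $0$ of $(K_{p,q},\sigma)$ satisfies $m(0)\ge p+q-2k-2$, where $k=\min(r,s)$.
   Context: A signed graph $\Gamma=(G,\sigma)$ consists of a simple graph $G$ and a sign function $\sigma:E(G)\to\{ -1,1\}$; edges with sign $-1$ are negative, those with sign $+1$ positive. Its adjacency matrix $A(\Gamma)=(a^\sigma_{ij})$ has $a^\sigma_{ij}=\sigma(v_iv_j)$ if $v_iv_j\in E(G)$ and $0$ otherwise. The eigenvalues of $\Gamma$ are those of $A(\Gamma)$, counted with multiplicity; $m(\lambda)$ denotes the multiplicity of eigenvalue $\lambda$. The induced signed subgraph on a vertex set carries the restricted sign function. $K_{p,q}$ is the complete bipartite graph with parts of sizes $p$ and $q$. -}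

module Defs where

open import Data.Nat using (ℕ; zero; suc)
open import Data.Integer as ℤ using (ℤ; 0ℤ; 1ℤ; -1ℤ)
open import Data.Bool using (Bool; true; false; if_then_else_)
open import Data.List using (List; []; _∷_; map; foldr)
open import Data.Fin using (Fin; zero; suc; splitAt; punchIn; toℕ)
open import Data.Fin.Properties using () renaming (_≟_ to _≟F_)
open import Data.Sum using (_⊎_; inj₁; inj₂)
open import Relation.Nullary using (does)

-- Polynomials over ℤ, as coefficient lists (lowest degree first).

Poly : Set
Poly = List ℤ

infixl 6 _+P_ _-P_
infixl 7 _*P_

_+P_ : Poly → Poly → Poly
[] +P q = q
(a ∷ p) +P [] = a ∷ p
(a ∷ p) +P (b ∷ q) = (a ℤ.+ b) ∷ (p +P q)

negP : Poly → Poly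
negP = map (λ a → ℤ.- a)

_-P_ : Poly → Poly → Poly
p -P q = p +P negP q

scaleP : ℤ → Poly → Poly
scaleP a = map (a ℤ.*_)

_*P_ : Poly → Poly → Poly
[] *P q = []
(a ∷ p) *P q = scaleP a q +P (0ℤ ∷ (p *P q))

constP : ℤ → Poly
constP c = c ∷ []

X : Poly
X = 0ℤ ∷ 1ℤ ∷ []

alt : ℕ → Poly → Poly
alt zero p = p
alt (suc n) p = negP (alt n p)

sumFin : ∀ n → (Fin n → Poly) → Poly
sumFin zero f = []
sumFin (suc n) f = f zero +P sumFin n (λ i → f (suc i))

minor : ∀ {n} → Fin (suc n) → (Fin (suc n) → Fin (suc n) → Poly) → Fin n → Fin n → Poly
minor j M i k = M (suc i) (punchIn j k)

det : ∀ n → (Fin n → Fin n → Poly) → Poly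
det zero M = constP 1ℤ
det (suc n) M = sumFin (suc n) (λ j → alt (toℕ j) (M zero j *P det n (minor j M)))

charPoly : ∀ n → (Fin n → Fin n → ℤ) → Poly
charPoly n A = det n (λ i j → (if does (i ≟F j) then X else []) -P constP (A i j))

ord0 : Poly → ℕ
ord0 [] = zero
ord0 (a ∷ p) = if does (a ℤ.≟ 0ℤ) then suc (ord0 p) else zero

mult0 : ∀ n → (Fin n → Fin n → ℤ) → ℕ
mult0 n A = ord0 (charPoly n A)

-- Signed complete bipartite graphs (K_{p,q}, σ).
-- σ u v = true means the edge u v is positive, false means negative.

SignedKpq : ℕ → ℕ → Set
SignedKpq p q = Fin p → Fin q → Bool

signℤ : Bool → ℤ
signℤ true = 1ℤ
signℤ false = -1ℤ

-- Vertices: Fin (p + q); the first p are U_p = {u_1..u_p}, the last q are V_q.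
adjKpq : ∀ p q → SignedKpq p q → Fin (p Data.Nat.+ q) → Fin (p Data.Nat.+ q) → ℤ
adjKpq p q σ i j with splitAt p i | splitAt p j
... | inj₁ u | inj₂ v = signℤ (σ u v)
... | inj₂ v | inj₁ u = signℤ (σ u v)
... | inj₁ _ | inj₁ _ = 0ℤ
... | inj₂ _ | inj₂ _ = 0ℤ

{-# OPTIONS --safe #-}

-- Write −A = J − 2P, where J and P are the symmetric bipartite matrices built from the
-- all-ones p × q matrix and the 0/1 matrix of positive edges. All positive edges lie in
-- Ur × Vs, so the positive-edge matrix is a sum of ∣ Ur ∣ rank-one matrices (its rows) and
-- also of ∣ Vs ∣ (its columns); hence −A = Σ_{s ∈ S} x_s y_sᵀ with ∣ S ∣ = 2k + 2.
-- Expanding det (tI − A) = det (tI + Σ_s x_s y_sᵀ) multilinearly in the columns, a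
-- nonvanishing term uses every x_s at most once and so keeps at least n − ∣ S ∣ factors t.
-- Thus t ^ (n − ∣ S ∣) divides the characteristic polynomial at every positive integer t,
-- which forces its n − ∣ S ∣ lowest coefficients to vanish.

module Submission where

open import Defs
open import Data.Nat as ℕ using (ℕ; zero; suc; _∸_; _⊓_; _≤_; z≤n; s≤s)
import Data.Nat.Properties as ℕₚ
open import Data.Integer using (ℤ; +0; -[1+_]; 0ℤ; 1ℤ; -1ℤ; +[1+_]; _^_)
import Data.Integer.Properties as ℤₚ
open import Data.Integer.Tactic.RingSolver using (solve-∀)
open import Data.Fin as Fin using (Fin; zero; suc; toℕ; inject₁; punchIn; punchOut)
open import Data.Fin.Properties
  using (_≟_; <-cmp; suc-injective; 0≢1+n; toℕ-injective; toℕ-inject₁; punchInᵢ≢i; punchIn-punchOut; punchIn-injective)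
open import Data.Vec.Functional using (updateAt)
open import Data.Vec.Functional.Properties using (updateAt-updates; updateAt-minimal; updateAt-id-local)
open import Data.Product using (∃; _,_; _×_)
open import Data.Empty using (⊥-elim)
open import Function using (_∘_; _∘₂_)
open import Relation.Nullary using (Dec; yes; no; does)
open import Relation.Binary.Definitions using (tri<; tri≈; tri>)
open import Relation.Binary.PropositionalEquality

module Determinant where

  open import Data.Integer using (_+_; _*_; -_)
  open import Data.Bool using (if_then_else_)
  open import Algebra.Properties.Semiring.Sum ℤₚ.+-*-semiring
  open import Algebra.Properties.CommutativeSemigroup ℤₚ.*-commutativeSemigroup using (x∙yz≈y∙xz)
  open import Algebra.Properties.CommutativeSemigroup ℤₚ.+-commutativeSemigroup
    using () renaming (x∙yz≈y∙xz to x+[y+z]≡y+[x+z])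
  open ≡-Reasoning

  Matrix : ℕ → Set
  Matrix n = Fin n → Fin n → ℤ

  δ : ∀ {n} → Fin n → Fin n → ℤ
  δ i j = if does (i ≟ j) then 1ℤ else 0ℤ

  minorℤ : ∀ {n} → Fin (suc n) → Matrix (suc n) → Matrix n
  minorℤ j M i k = M (suc i) (punchIn j k)

  detℤ : ∀ n → Matrix n → ℤ
  detℤ zero    M = 1ℤ
  detℤ (suc n) M = ∑[ j < suc n ] (-1ℤ ^ toℕ j * (M zero j * detℤ n (minorℤ j M)))

  laplaceTerm : ∀ n → Matrix (suc n) → Fin (suc n) → ℤ
  laplaceTerm n M j = M zero j * detℤ n (minorℤ j M)

  detℤ-cong : ∀ n {M M′ : Matrix n} → (∀ i j → M i j ≡ M′ i j) → detℤ n M ≡ detℤ n M′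
  detℤ-cong zero    eq = refl
  detℤ-cong (suc n) eq = sum-cong-≗ λ j →
    cong₂ (λ x y → -1ℤ ^ toℕ j * (x * y)) (eq zero j) (detℤ-cong n (λ i k → eq (suc i) (punchIn j k)))

  setColumn : ∀ {n} → Matrix n → Fin n → (Fin n → ℤ) → Matrix n
  setColumn M c v i = updateAt (M i) c (λ _ → v i)

  setColumn-updates : ∀ {n} (M : Matrix n) c v i → setColumn M c v i c ≡ v i
  setColumn-updates M c v i = updateAt-updates c (M i)

  setColumn-minimal : ∀ {n} (M : Matrix n) {c j} v i → j ≢ c → setColumn M c v i j ≡ M i j
  setColumn-minimal M {c} {j} v i = updateAt-minimal j c (M i)

  setColumn-unchanged : ∀ {n} (M : Matrix n) {c v} → (∀ i → v i ≡ M i c) → ∀ i j → setColumn M c v i j ≡ M i j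
  setColumn-unchanged M {c} v≡ i = updateAt-id-local c (M i) (v≡ i)

  minor-setColumn-same : ∀ {n} (M : Matrix (suc n)) c v i k → minorℤ c (setColumn M c v) i k ≡ minorℤ c M i k
  minor-setColumn-same M c v i k = setColumn-minimal M v (suc i) (punchInᵢ≢i c k)

  minor-setColumn-other : ∀ {n} (M : Matrix (suc n)) {j c} (j≢c : j ≢ c) v i k →
    minorℤ j (setColumn M c v) i k ≡ setColumn (minorℤ j M) (punchOut j≢c) (v ∘ suc) i k
  minor-setColumn-other M {j} {c} j≢c v i k with k ≟ punchOut j≢c
  ... | yes refl = begin
    setColumn M c v (suc i) (punchIn j (punchOut j≢c))  ≡⟨ cong (setColumn M c v (suc i)) (punchIn-punchOut j≢c) ⟩
    setColumn M c v (suc i) c                           ≡⟨ setColumn-updates M c v (suc i) ⟩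
    v (suc i)                                           ≡⟨ setColumn-updates (minorℤ j M) (punchOut j≢c) (v ∘ suc) i ⟨
    setColumn (minorℤ j M) (punchOut j≢c) (v ∘ suc) i (punchOut j≢c)  ∎
  ... | no k≢ = trans (setColumn-minimal M v (suc i) punchIn≢c) (sym (setColumn-minimal (minorℤ j M) (v ∘ suc) i k≢))
    where
    punchIn≢c : punchIn j k ≢ c
    punchIn≢c eq = k≢ (punchIn-injective j k _ (trans eq (sym (punchIn-punchOut j≢c))))

  detℤ-setColumn-∑ : ∀ n (M : Matrix n) c {K} (a : Fin K → ℤ) (v : Fin K → Fin n → ℤ) →
    detℤ n (setColumn M c (λ i → ∑[ s < K ] (a s * v s i))) ≡ ∑[ s < K ] (a s * detℤ n (setColumn M c (v s)))

  laplaceTerm-setColumn-∑ : ∀ n (M : Matrix (suc n)) c {K} (a : Fin K → ℤ) (v : Fin K → Fin (suc n) → ℤ) j →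
    laplaceTerm n (setColumn M c (λ i → ∑[ s < K ] (a s * v s i))) j
      ≡ ∑[ s < K ] (a s * laplaceTerm n (setColumn M c (v s)) j)

  detℤ-setColumn-∑ (suc n) M c {K} a v = begin
    ∑[ j < suc n ] (sign j * laplaceTerm n (setColumn M c combination) j)
      ≡⟨ sum-cong-≗ (λ j → cong (sign j *_) (laplaceTerm-setColumn-∑ n M c a v j)) ⟩
    ∑[ j < suc n ] (sign j * ∑[ s < K ] (a s * term s j))
      ≡⟨ sum-cong-≗ (λ j → *-distribˡ-sum (sign j) (λ s → a s * term s j)) ⟩
    ∑[ j < suc n ] ∑[ s < K ] (sign j * (a s * term s j))
      ≡⟨ ∑-comm (λ j s → sign j * (a s * term s j)) ⟩
    ∑[ s < K ] ∑[ j < suc n ] (sign j * (a s * term s j))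
      ≡⟨ sum-cong-≗ (λ s → sum-cong-≗ (λ j → x∙yz≈y∙xz (sign j) (a s) (term s j))) ⟩
    ∑[ s < K ] ∑[ j < suc n ] (a s * (sign j * term s j))
      ≡⟨ sum-cong-≗ (λ s → *-distribˡ-sum (a s) (λ j → sign j * term s j)) ⟨
    ∑[ s < K ] (a s * detℤ (suc n) (setColumn M c (v s)))  ∎
    where
    combination : Fin (suc n) → ℤ
    combination i = ∑[ s < K ] (a s * v s i)
    sign : Fin (suc n) → ℤ
    sign j = -1ℤ ^ toℕ j
    term : Fin K → Fin (suc n) → ℤ
    term s = laplaceTerm n (setColumn M c (v s))

  laplaceTerm-setColumn-∑ n M c {K} a v j with j ≟ c
  ... | yes refl = begin
    setColumn M c combination zero c * detℤ n (minorℤ c (setColumn M c combination))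
      ≡⟨ cong₂ _*_ (setColumn-updates M c combination zero) (detℤ-cong n (minor-setColumn-same M c combination)) ⟩
    ∑[ s < K ] (a s * v s zero) * d                ≡⟨ *-distribʳ-sum d (λ s → a s * v s zero) ⟩
    ∑[ s < K ] (a s * v s zero * d)                ≡⟨ sum-cong-≗ (λ s → ℤₚ.*-assoc (a s) (v s zero) d) ⟩
    ∑[ s < K ] (a s * (v s zero * d))
      ≡⟨ sum-cong-≗ (λ s → cong (a s *_) (sym (cong₂ _*_ (setColumn-updates M c (v s) zero)
                                                        (detℤ-cong n (minor-setColumn-same M c (v s)))))) ⟩
    ∑[ s < K ] (a s * laplaceTerm n (setColumn M c (v s)) c)  ∎
    where
    combination : Fin (suc n) → ℤ
    combination i = ∑[ s < K ] (a s * v s i)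
    d = detℤ n (minorℤ c M)
  ... | no j≢c = begin
    setColumn M c combination zero j * detℤ n (minorℤ j (setColumn M c combination))
      ≡⟨ cong₂ _*_ (setColumn-minimal M combination zero j≢c) (detℤ-cong n (minor-setColumn-other M j≢c combination)) ⟩
    M zero j * detℤ n (setColumn (minorℤ j M) (punchOut j≢c) (combination ∘ suc))
      ≡⟨ cong (M zero j *_) (detℤ-setColumn-∑ n (minorℤ j M) (punchOut j≢c) a (λ s → v s ∘ suc)) ⟩
    M zero j * ∑[ s < K ] (a s * d s)              ≡⟨ *-distribˡ-sum (M zero j) (λ s → a s * d s) ⟩
    ∑[ s < K ] (M zero j * (a s * d s))            ≡⟨ sum-cong-≗ (λ s → x∙yz≈y∙xz (M zero j) (a s) (d s)) ⟩
    ∑[ s < K ] (a s * (M zero j * d s))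
      ≡⟨ sum-cong-≗ (λ s → cong (a s *_) (sym (cong₂ _*_ (setColumn-minimal M (v s) zero j≢c)
                                                        (detℤ-cong n (minor-setColumn-other M j≢c (v s)))))) ⟩
    ∑[ s < K ] (a s * laplaceTerm n (setColumn M c (v s)) j)  ∎
    where
    combination : Fin (suc n) → ℤ
    combination i = ∑[ s < K ] (a s * v s i)
    d : Fin K → ℤ
    d s = detℤ n (setColumn (minorℤ j M) (punchOut j≢c) (v s ∘ suc))

  detℤ-zero-column : ∀ n (M : Matrix n) c → (∀ i → M i c ≡ 0ℤ) → detℤ n M ≡ 0ℤ
  detℤ-zero-column n M c zero-column = begin
    detℤ n M                            ≡⟨ detℤ-cong n (setColumn-unchanged M (sym ∘ zero-column)) ⟨
    detℤ n (setColumn M c (λ _ → 0ℤ))   ≡⟨ detℤ-setColumn-∑ n M c {0} (λ ()) (λ ()) ⟩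
    0ℤ                                  ∎

  swapAdjacent : ∀ {n} → Fin n → Fin (suc n) → Fin (suc n)
  swapAdjacent zero    zero          = suc zero
  swapAdjacent zero    (suc zero)    = zero
  swapAdjacent zero    (suc (suc j)) = suc (suc j)
  swapAdjacent (suc c) zero          = zero
  swapAdjacent (suc c) (suc j)       = suc (swapAdjacent c j)

  swapAdjacent-inject₁ : ∀ {n} (c : Fin n) → swapAdjacent c (inject₁ c) ≡ suc c
  swapAdjacent-inject₁ zero    = refl
  swapAdjacent-inject₁ (suc c) = cong suc (swapAdjacent-inject₁ c)

  swapAdjacent-suc : ∀ {n} (c : Fin n) → swapAdjacent c (suc c) ≡ inject₁ c
  swapAdjacent-suc zero    = refl
  swapAdjacent-suc (suc c) = cong suc (swapAdjacent-suc c)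

  swapAdjacent-other : ∀ {n} (c : Fin n) {j} → j ≢ inject₁ c → j ≢ suc c → swapAdjacent c j ≡ j
  swapAdjacent-other zero    {zero}        j≢c _     = ⊥-elim (j≢c refl)
  swapAdjacent-other zero    {suc zero}    _   j≢1+c = ⊥-elim (j≢1+c refl)
  swapAdjacent-other zero    {suc (suc j)} _   _     = refl
  swapAdjacent-other (suc c) {zero}        _   _     = refl
  swapAdjacent-other (suc c) {suc j}       j≢c j≢1+c = cong suc (swapAdjacent-other c (j≢c ∘ cong suc) (j≢1+c ∘ cong suc))

  swapAdjacent-punchIn-inject₁ : ∀ {n} (c : Fin n) k → swapAdjacent c (punchIn (inject₁ c) k) ≡ punchIn (suc c) k
  swapAdjacent-punchIn-inject₁ zero    zero    = refl
  swapAdjacent-punchIn-inject₁ zero    (suc k) = refl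
  swapAdjacent-punchIn-inject₁ (suc c) zero    = refl
  swapAdjacent-punchIn-inject₁ (suc c) (suc k) = cong suc (swapAdjacent-punchIn-inject₁ c k)

  swapAdjacent-punchIn-suc : ∀ {n} (c : Fin n) k → swapAdjacent c (punchIn (suc c) k) ≡ punchIn (inject₁ c) k
  swapAdjacent-punchIn-suc zero    zero    = refl
  swapAdjacent-punchIn-suc zero    (suc k) = refl
  swapAdjacent-punchIn-suc (suc c) zero    = refl
  swapAdjacent-punchIn-suc (suc c) (suc k) = cong suc (swapAdjacent-punchIn-suc c k)

  swapAdjacent-punchIn-other : ∀ {n} (c : Fin (suc n)) {j} → j ≢ inject₁ c → j ≢ suc c →
    ∃ λ c′ → ∀ k → swapAdjacent c (punchIn j k) ≡ punchIn j (swapAdjacent c′ k)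
  swapAdjacent-punchIn-other         zero    {zero}        j≢c _     = ⊥-elim (j≢c refl)
  swapAdjacent-punchIn-other         zero    {suc zero}    _   j≢1+c = ⊥-elim (j≢1+c refl)
  swapAdjacent-punchIn-other {zero}  zero    {suc (suc ())} _  _
  swapAdjacent-punchIn-other {suc n} zero    {suc (suc j)} _   _     =
    zero , λ { zero → refl ; (suc zero) → refl ; (suc (suc k)) → refl }
  swapAdjacent-punchIn-other {suc n} (suc c) {zero}        _   _     = c , λ k → refl
  swapAdjacent-punchIn-other {suc n} (suc c) {suc j}       j≢c j≢1+c
    with c′ , swap-punchIn ← swapAdjacent-punchIn-other c (j≢c ∘ cong suc) (j≢1+c ∘ cong suc)
    = suc c′ , λ { zero → refl ; (suc k) → cong suc (swap-punchIn k) }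

  ∑-swapAdjacent : ∀ {n} (c : Fin n) (f : Fin (suc n) → ℤ) → ∑[ j < suc n ] f (swapAdjacent c j) ≡ ∑[ j < suc n ] f j
  ∑-swapAdjacent zero    f = x+[y+z]≡y+[x+z] (f (suc zero)) (f zero) _
  ∑-swapAdjacent (suc c) f = cong (f zero +_) (∑-swapAdjacent c (f ∘ suc))

  swapColumns : ∀ {n} → Fin n → Matrix (suc n) → Matrix (suc n)
  swapColumns c M i j = M i (swapAdjacent c j)

  laplaceTerm-swapColumns-inject₁ : ∀ n (c : Fin n) M →
                                    laplaceTerm n (swapColumns c M) (inject₁ c) ≡ laplaceTerm n M (suc c)
  laplaceTerm-swapColumns-inject₁ n c M = cong₂ _*_ (cong (M zero) (swapAdjacent-inject₁ c))
    (detℤ-cong n λ i k → cong (M (suc i)) (swapAdjacent-punchIn-inject₁ c k))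

  laplaceTerm-swapColumns-suc : ∀ n (c : Fin n) M →
                                laplaceTerm n (swapColumns c M) (suc c) ≡ laplaceTerm n M (inject₁ c)
  laplaceTerm-swapColumns-suc n c M = cong₂ _*_ (cong (M zero) (swapAdjacent-suc c))
    (detℤ-cong n λ i k → cong (M (suc i)) (swapAdjacent-punchIn-suc c k))

  detℤ-swapColumns : ∀ n (c : Fin n) (M : Matrix (suc n)) → detℤ (suc n) (swapColumns c M) ≡ - detℤ (suc n) M

  laplaceTerm-swapColumns-other : ∀ n (c : Fin (suc n)) M {j} → j ≢ inject₁ c → j ≢ suc c →
                                  laplaceTerm (suc n) (swapColumns c M) j ≡ - laplaceTerm (suc n) M j
  laplaceTerm-swapColumns-other n c M {j} j≢c j≢1+c with c′ , swap-punchIn ← swapAdjacent-punchIn-other c j≢c j≢1+c = begin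
    M zero (swapAdjacent c j) * detℤ (suc n) (minorℤ j (swapColumns c M))
      ≡⟨ cong₂ _*_ (cong (M zero) (swapAdjacent-other c j≢c j≢1+c))
                   (trans (detℤ-cong (suc n) λ i k → cong (M (suc i)) (swap-punchIn k))
                          (detℤ-swapColumns n c′ (minorℤ j M))) ⟩
    M zero j * - detℤ (suc n) (minorℤ j M)   ≡⟨ ℤₚ.neg-distribʳ-* (M zero j) (detℤ (suc n) (minorℤ j M)) ⟨
    - laplaceTerm (suc n) M j                ∎

  detℤ-swapColumns (suc n) c M = begin
    ∑[ j < suc (suc n) ] signed (swapColumns c M) j         ≡⟨ sum-cong-≗ signed-swap ⟩
    ∑[ j < suc (suc n) ] (-1ℤ * signed M (swapAdjacent c j)) ≡⟨ *-distribˡ-sum -1ℤ (signed M ∘ swapAdjacent c) ⟨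
    -1ℤ * ∑[ j < suc (suc n) ] signed M (swapAdjacent c j)   ≡⟨ cong (-1ℤ *_) (∑-swapAdjacent c (signed M)) ⟩
    -1ℤ * detℤ (suc (suc n)) M                               ≡⟨ ℤₚ.-1*i≡-i (detℤ (suc (suc n)) M) ⟩
    - detℤ (suc (suc n)) M                                   ∎
    where
    signed : Matrix (suc (suc n)) → Fin (suc (suc n)) → ℤ
    signed N j = -1ℤ ^ toℕ j * laplaceTerm (suc n) N j
    flip-sign : ∀ s x → s * x ≡ -1ℤ * ((-1ℤ * s) * x)
    flip-sign = solve-∀
    signed-swap : ∀ j → signed (swapColumns c M) j ≡ -1ℤ * signed M (swapAdjacent c j)
    signed-swap j with j ≟ inject₁ c | j ≟ suc c
    ... | yes refl | _ = begin
      -1ℤ ^ toℕ (inject₁ c) * laplaceTerm (suc n) (swapColumns c M) (inject₁ c)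
        ≡⟨ cong₂ (λ k x → -1ℤ ^ k * x) (toℕ-inject₁ c) (laplaceTerm-swapColumns-inject₁ (suc n) c M) ⟩
      -1ℤ ^ toℕ c * laplaceTerm (suc n) M (suc c)      ≡⟨ flip-sign (-1ℤ ^ toℕ c) _ ⟩
      -1ℤ * signed M (suc c)                           ≡⟨ cong (λ x → -1ℤ * signed M x) (swapAdjacent-inject₁ c) ⟨
      -1ℤ * signed M (swapAdjacent c (inject₁ c))      ∎
    ... | no _ | yes refl = begin
      -1ℤ * -1ℤ ^ toℕ c * laplaceTerm (suc n) (swapColumns c M) (suc c)
        ≡⟨ cong₂ (λ k x → -1ℤ * -1ℤ ^ k * x) (sym (toℕ-inject₁ c)) (laplaceTerm-swapColumns-suc (suc n) c M) ⟩
      -1ℤ * -1ℤ ^ toℕ (inject₁ c) * laplaceTerm (suc n) M (inject₁ c)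
        ≡⟨ ℤₚ.*-assoc -1ℤ (-1ℤ ^ toℕ (inject₁ c)) (laplaceTerm (suc n) M (inject₁ c)) ⟩
      -1ℤ * signed M (inject₁ c)                       ≡⟨ cong (λ x → -1ℤ * signed M x) (swapAdjacent-suc c) ⟨
      -1ℤ * signed M (swapAdjacent c (suc c))          ∎
    ... | no j≢c | no j≢1+c = begin
      -1ℤ ^ toℕ j * laplaceTerm (suc n) (swapColumns c M) j
        ≡⟨ cong (-1ℤ ^ toℕ j *_) (laplaceTerm-swapColumns-other n c M j≢c j≢1+c) ⟩
      -1ℤ ^ toℕ j * - laplaceTerm (suc n) M j          ≡⟨ ℤₚ.neg-distribʳ-* (-1ℤ ^ toℕ j) (laplaceTerm (suc n) M j) ⟨
      - signed M j                                     ≡⟨ ℤₚ.-1*i≡-i (signed M j) ⟨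
      -1ℤ * signed M j                                 ≡⟨ cong (λ x → -1ℤ * signed M x) (swapAdjacent-other c j≢c j≢1+c) ⟨
      -1ℤ * signed M (swapAdjacent c j)                ∎

  x≡-x⇒x≡0 : ∀ x → x ≡ - x → x ≡ 0ℤ
  x≡-x⇒x≡0 x x≡-x = ℤₚ.*-cancelˡ-≡ +[1+ 1 ] x 0ℤ (begin
    +[1+ 1 ] * x  ≡⟨ doubling x ⟩
    x + x         ≡⟨ cong (x +_) x≡-x ⟩
    x + - x       ≡⟨ ℤₚ.+-inverseʳ x ⟩
    0ℤ            ∎)
    where
    doubling : ∀ x → +[1+ 1 ] * x ≡ x + x
    doubling = solve-∀

  detℤ-adjacent-equal-columns : ∀ n (c : Fin n) (M : Matrix (suc n)) →
                                (∀ i → M i (inject₁ c) ≡ M i (suc c)) → detℤ (suc n) M ≡ 0ℤ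
  detℤ-adjacent-equal-columns n c M equal =
    x≡-x⇒x≡0 _ (trans (detℤ-cong (suc n) swap-invariant) (detℤ-swapColumns n c M))
    where
    swap-invariant : ∀ i j → M i j ≡ swapColumns c M i j
    swap-invariant i j with j ≟ inject₁ c | j ≟ suc c
    ... | yes refl | _        = trans (equal i) (cong (M i) (sym (swapAdjacent-inject₁ c)))
    ... | no _     | yes refl = trans (sym (equal i)) (cong (M i) (sym (swapAdjacent-suc c)))
    ... | no j≢c   | no j≢1+c = cong (M i) (sym (swapAdjacent-other c j≢c j≢1+c))

  detℤ-equal-columns-at-distance : ∀ d {n} (M : Matrix (suc n)) a (c : Fin n) → toℕ c ≡ d ℕ.+ toℕ a →
                                   (∀ i → M i a ≡ M i (suc c)) → detℤ (suc n) M ≡ 0ℤ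
  detℤ-equal-columns-at-distance zero {n} M a c c≡a equal =
    detℤ-adjacent-equal-columns n c M (λ i → trans (cong (M i) (sym a≡c)) (equal i))
    where
    a≡c : a ≡ inject₁ c
    a≡c = toℕ-injective (sym (trans (toℕ-inject₁ c) c≡a))
  -- Swapping columns c and c + 1 moves the copy of column a one step closer to it.
  detℤ-equal-columns-at-distance (suc d) {suc n} M a (suc c) c≡a equal =
    ℤₚ.neg-injective (trans (sym (detℤ-swapColumns (suc n) (suc c) M)) swapped-singular)
    where
    a<1+c : toℕ a ℕ.< toℕ (suc c)
    a<1+c = subst (suc (toℕ a) ℕ.≤_) (sym c≡a) (s≤s (ℕₚ.m≤n+m (toℕ a) d))
    a≢c : a ≢ suc (inject₁ c)
    a≢c a≡c = ℕₚ.<-irrefl (trans (cong toℕ a≡c) (toℕ-inject₁ (suc c))) a<1+c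
    a≢1+c : a ≢ suc (suc c)
    a≢1+c refl = ℕₚ.<-asym (ℕₚ.n<1+n (toℕ (suc c))) a<1+c
    swapped-singular : detℤ (suc (suc n)) (swapColumns (suc c) M) ≡ 0ℤ
    swapped-singular = detℤ-equal-columns-at-distance d (swapColumns (suc c) M) a (inject₁ c)
      (trans (toℕ-inject₁ c) (ℕₚ.suc-injective c≡a))
      (λ i → trans (cong (M i) (swapAdjacent-other (suc c) a≢c a≢1+c))
                   (trans (equal i) (cong (M i) (sym (swapAdjacent-inject₁ (suc c))))))

  detℤ-equal-columns-< : ∀ {n} (M : Matrix n) {a b} → a Fin.< b → (∀ i → M i a ≡ M i b) → detℤ n M ≡ 0ℤ
  detℤ-equal-columns-< {suc n} M {a} {suc c} a<b =
    detℤ-equal-columns-at-distance (toℕ c ∸ toℕ a) M a c (sym (ℕₚ.m∸n+n≡m (ℕₚ.≤-pred a<b)))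

  detℤ-equal-columns : ∀ n (M : Matrix n) {a b} → a ≢ b → (∀ i → M i a ≡ M i b) → detℤ n M ≡ 0ℤ
  detℤ-equal-columns n M {a} {b} a≢b equal with <-cmp a b
  ... | tri< a<b _ _ = detℤ-equal-columns-< M a<b equal
  ... | tri≈ _ a≡b _ = ⊥-elim (a≢b a≡b)
  ... | tri> _ _ b<a = detℤ-equal-columns-< M b<a (sym ∘ equal)

module CharacteristicPolynomial where

  open import Data.Integer using (_+_; _*_; -_)
  open import Data.Integer.Divisibility.Signed
    using (_∣_; ∣-refl; ∣-trans; ∣⇒∣ᵤ; ∣m+n∣n⇒∣m; ∣m⇒∣m*n; *-cancelˡ-∣)
  open import Data.Nat.Divisibility using (∣⇒≤)
  open import Data.List using ([]; _∷_; length)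
  open import Data.List.Properties using (length-map)
  open import Data.Bool using (true; false; if_then_else_)
  open import Relation.Nullary.Decidable using (dec-true)
  open import Algebra.Properties.Semiring.Sum ℤₚ.+-*-semiring
  open Determinant
  open ≡-Reasoning

  eval : Poly → ℤ → ℤ
  eval []      t = 0ℤ
  eval (a ∷ p) t = a + t * eval p t

  eval-+P : ∀ p q t → eval (p +P q) t ≡ eval p t + eval q t
  eval-+P []      q       t = sym (ℤₚ.+-identityˡ _)
  eval-+P (a ∷ p) []      t = sym (ℤₚ.+-identityʳ _)
  eval-+P (a ∷ p) (b ∷ q) t = begin
    a + b + t * eval (p +P q) t            ≡⟨ cong (λ x → a + b + t * x) (eval-+P p q t) ⟩
    a + b + t * (eval p t + eval q t)      ≡⟨ interchange a b t (eval p t) (eval q t) ⟩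
    a + t * eval p t + (b + t * eval q t)  ∎
    where
    interchange : ∀ a b t x y → a + b + t * (x + y) ≡ a + t * x + (b + t * y)
    interchange = solve-∀

  eval-negP : ∀ p t → eval (negP p) t ≡ - eval p t
  eval-negP []      t = refl
  eval-negP (a ∷ p) t = trans (cong (λ x → - a + t * x) (eval-negP p t)) (negate a t (eval p t))
    where
    negate : ∀ a t x → - a + t * - x ≡ - (a + t * x)
    negate = solve-∀

  eval-scaleP : ∀ c p t → eval (scaleP c p) t ≡ c * eval p t
  eval-scaleP c []      t = sym (ℤₚ.*-zeroʳ c)
  eval-scaleP c (a ∷ p) t = trans (cong (λ x → c * a + t * x) (eval-scaleP c p t)) (scale c a t (eval p t))
    where
    scale : ∀ c a t x → c * a + t * (c * x) ≡ c * (a + t * x)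
    scale = solve-∀

  eval-*P : ∀ p q t → eval (p *P q) t ≡ eval p t * eval q t
  eval-*P []      q t = sym (ℤₚ.*-zeroˡ (eval q t))
  eval-*P (a ∷ p) q t = begin
    eval (scaleP a q +P (0ℤ ∷ p *P q)) t          ≡⟨ eval-+P (scaleP a q) (0ℤ ∷ p *P q) t ⟩
    eval (scaleP a q) t + (0ℤ + t * eval (p *P q) t)
                                                 ≡⟨ cong₂ (λ x y → x + (0ℤ + t * y)) (eval-scaleP a q t) (eval-*P p q t) ⟩
    a * eval q t + (0ℤ + t * (eval p t * eval q t)) ≡⟨ expand a t (eval p t) (eval q t) ⟩
    (a + t * eval p t) * eval q t                 ∎
    where
    expand : ∀ a t x y → a * y + (0ℤ + t * (x * y)) ≡ (a + t * x) * y
    expand = solve-∀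

  eval-alt : ∀ k p t → eval (alt k p) t ≡ -1ℤ ^ k * eval p t
  eval-alt zero    p t = sym (ℤₚ.*-identityˡ _)
  eval-alt (suc k) p t = begin
    eval (negP (alt k p)) t       ≡⟨ eval-negP (alt k p) t ⟩
    - eval (alt k p) t            ≡⟨ cong -_ (eval-alt k p t) ⟩
    - (-1ℤ ^ k * eval p t)        ≡⟨ ℤₚ.-1*i≡-i _ ⟨
    -1ℤ * (-1ℤ ^ k * eval p t)    ≡⟨ ℤₚ.*-assoc -1ℤ (-1ℤ ^ k) (eval p t) ⟨
    -1ℤ ^ suc k * eval p t        ∎

  eval-sumFin : ∀ n f t → eval (sumFin n f) t ≡ ∑[ i < n ] eval (f i) t
  eval-sumFin zero    f t = refl
  eval-sumFin (suc n) f t =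
    trans (eval-+P (f zero) _ t) (cong (eval (f zero) t +_) (eval-sumFin n (f ∘ suc) t))

  eval-det : ∀ n M t → eval (det n M) t ≡ detℤ n (λ i j → eval (M i j) t)
  eval-det zero    M t = cong (1ℤ +_) (ℤₚ.*-zeroʳ t)
  eval-det (suc n) M t =
    trans (eval-sumFin (suc n) (λ j → alt (toℕ j) (M zero j *P det n (minor j M))) t) (sum-cong-≗ λ j → begin
    eval (alt (toℕ j) (M zero j *P det n (minor j M))) t
                                   ≡⟨ eval-alt (toℕ j) _ t ⟩
    -1ℤ ^ toℕ j * eval (M zero j *P det n (minor j M)) t
                                   ≡⟨ cong (-1ℤ ^ toℕ j *_) (eval-*P (M zero j) _ t) ⟩
    -1ℤ ^ toℕ j * (eval (M zero j) t * eval (det n (minor j M)) t)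
                                   ≡⟨ cong (λ x → -1ℤ ^ toℕ j * (eval (M zero j) t * x)) (eval-det n (minor j M) t) ⟩
    -1ℤ ^ toℕ j * (eval (M zero j) t * detℤ n (minorℤ j (λ i k → eval (M i k) t))) ∎)

  charMatrix : ∀ n → (Fin n → Fin n → ℤ) → Fin n → Fin n → Poly
  charMatrix n A i j = (if does (i ≟ j) then X else []) -P constP (A i j)

  eval-charMatrix : ∀ n A t i j → eval (charMatrix n A i j) t ≡ t * δ i j + - A i j
  eval-charMatrix n A t i j = begin
    eval ((if does (i ≟ j) then X else []) -P constP (A i j)) t
      ≡⟨ eval-+P (if does (i ≟ j) then X else []) (negP (constP (A i j))) t ⟩
    eval (if does (i ≟ j) then X else []) t + (- A i j + t * 0ℤ)
      ≡⟨ cong₂ _+_ (eval-diagonal (does (i ≟ j))) (eval-constant (- A i j)) ⟩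
    t * δ i j + - A i j  ∎
    where
    eval-X : ∀ t → 0ℤ + t * (1ℤ + t * 0ℤ) ≡ t * 1ℤ
    eval-X = solve-∀
    eval-diagonal : ∀ b → eval (if b then X else []) t ≡ t * (if b then 1ℤ else 0ℤ)
    eval-diagonal true  = eval-X t
    eval-diagonal false = sym (ℤₚ.*-zeroʳ t)
    eval-constant : ∀ c → c + t * 0ℤ ≡ c
    eval-constant c = trans (cong (c +_) (ℤₚ.*-zeroʳ t)) (ℤₚ.+-identityʳ c)

  eval-charPoly : ∀ n A t → eval (charPoly n A) t ≡ detℤ n (λ i j → t * δ i j + - A i j)
  eval-charPoly n A t = trans (eval-det n (charMatrix n A) t) (detℤ-cong n (eval-charMatrix n A t))

  length-+P-≥ˡ : ∀ p q → length p ≤ length (p +P q)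
  length-+P-≥ˡ []      q       = z≤n
  length-+P-≥ˡ (a ∷ p) []      = ℕₚ.≤-refl
  length-+P-≥ˡ (a ∷ p) (b ∷ q) = s≤s (length-+P-≥ˡ p q)

  length-+P-≥ʳ : ∀ p q → length q ≤ length (p +P q)
  length-+P-≥ʳ []      q       = ℕₚ.≤-refl
  length-+P-≥ʳ (a ∷ p) []      = z≤n
  length-+P-≥ʳ (a ∷ p) (b ∷ q) = s≤s (length-+P-≥ʳ p q)

  length-*P : ∀ p q → 2 ≤ length p → suc (length q) ≤ length (p *P q)
  length-*P (a ∷ b ∷ p) q _ = ℕₚ.≤-trans (s≤s length-q≤) (length-+P-≥ʳ (scaleP a q) (0ℤ ∷ (b ∷ p) *P q))
    where
    length-q≤ : length q ≤ length ((b ∷ p) *P q)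
    length-q≤ = ℕₚ.≤-trans (ℕₚ.≤-reflexive (sym (length-map (b *_) q))) (length-+P-≥ˡ (scaleP b q) (0ℤ ∷ p *P q))
  length-*P (a ∷ []) q (s≤s ())

  length-det : ∀ n M → (∀ i → 2 ≤ length (M i i)) → suc n ≤ length (det n M)
  length-det zero    M _       = ℕₚ.≤-refl
  length-det (suc n) M long-diagonal = ℕₚ.≤-trans
    (ℕₚ.≤-trans (s≤s (length-det n (minor zero M) (long-diagonal ∘ suc)))
                (length-*P (M zero zero) (det n (minor zero M)) (long-diagonal zero)))
    (length-+P-≥ˡ (M zero zero *P det n (minor zero M)) _)

  length-charPoly : ∀ n A → suc n ≤ length (charPoly n A)
  length-charPoly n A = length-det n (charMatrix n A) long-diagonal
    where
    long-diagonal : ∀ i → 2 ≤ length (charMatrix n A i i)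
    long-diagonal i rewrite dec-true (i ≟ i) refl = ℕₚ.≤-refl

  divisible-by-all⇒≡0 : ∀ a → (∀ s → +[1+ s ] ∣ a) → a ≡ 0ℤ
  divisible-by-all⇒≡0 +0        _         = refl
  divisible-by-all⇒≡0 +[1+ k ]  divisible = ⊥-elim (ℕₚ.<-irrefl refl (∣⇒≤ (∣⇒∣ᵤ (divisible (suc k)))))
  divisible-by-all⇒≡0 -[1+ k ]  divisible = ⊥-elim (ℕₚ.<-irrefl refl (∣⇒≤ (∣⇒∣ᵤ (divisible (suc k)))))

  -- ord0 only inspects the stored coefficients, hence the hypothesis on length p.
  ord0-≥ : ∀ d p → d ≤ length p → (∀ s → +[1+ s ] ^ d ∣ eval p +[1+ s ]) → d ≤ ord0 p
  ord0-≥ zero    p       _           _         = z≤n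
  ord0-≥ (suc d) (a ∷ p) (s≤s d≤len) divisible =
    subst (λ x → suc d ≤ ord0 (x ∷ p)) (sym a≡0) (s≤s (ord0-≥ d p d≤len tail-divisible))
    where
    t∣constant : ∀ s → +[1+ s ] ∣ a + +[1+ s ] * eval p +[1+ s ] → +[1+ s ] ∣ a
    t∣constant s t∣value = ∣m+n∣n⇒∣m t∣value (∣m⇒∣m*n (eval p +[1+ s ]) ∣-refl)
    a≡0 : a ≡ 0ℤ
    a≡0 = divisible-by-all⇒≡0 a λ s → t∣constant s (∣-trans (∣m⇒∣m*n _ ∣-refl) (divisible s))
    tail-divisible : ∀ s → +[1+ s ] ^ d ∣ eval p +[1+ s ]
    tail-divisible s = *-cancelˡ-∣ +[1+ s ]
      (subst (+[1+ s ] ^ suc d ∣_) (trans (cong (_+ +[1+ s ] * eval p +[1+ s ]) a≡0) (ℤₚ.+-identityˡ _)) (divisible s))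

  mult0-≥ : ∀ n A e → e ≤ n →
            (∀ s → +[1+ s ] ^ e ∣ detℤ n (λ i j → +[1+ s ] * δ i j + - A i j)) → e ≤ mult0 n A
  mult0-≥ n A e e≤n divisible = ord0-≥ e (charPoly n A)
    (ℕₚ.≤-trans e≤n (ℕₚ.≤-trans (ℕₚ.n≤1+n n) (length-charPoly n A)))
    (λ s → subst (+[1+ s ] ^ e ∣_) (sym (eval-charPoly n A +[1+ s ])) (divisible s))

module Counting where

  open import Data.Nat using (_+_)
  open import Data.Maybe using (Maybe; just; nothing)
  open import Data.Fin.Subset using (Subset; _∈_; ∣_∣; _-_)
  open import Data.Fin.Subset.Properties using (x∈p⇒∣p-x∣<∣p∣; x∈p∧x≢y⇒x∈p-y)
  open import Algebra.Properties.Semiring.Sum ℕₚ.+-*-semiring using (sum; sum-remove; sum-cong-≗)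
  open import Algebra.Properties.CommutativeSemigroup ℕₚ.+-commutativeSemigroup using (xy∙z≈zy∙x)

  defined : ∀ {A : Set} → Maybe A → ℕ
  defined (just _) = 1
  defined nothing  = 0

  sum-defined-≤ : ∀ {n N} (f : Fin n → Maybe (Fin N)) (S : Subset N) →
                  (∀ {c s} → f c ≡ just s → s ∈ S) →
                  (∀ {c c′ s} → f c ≡ just s → f c′ ≡ just s → c ≡ c′) →
                  sum (defined ∘ f) ≤ ∣ S ∣
  sum-defined-≤ {zero}  f S _     _         = z≤n
  sum-defined-≤ {suc n} f S into injective with f zero in f0≡
  ... | nothing = sum-defined-≤ (f ∘ suc) S into (suc-injective ∘₂ injective)
  ... | just s  = ℕₚ.<-≤-trans (s≤s (sum-defined-≤ (f ∘ suc) (S - s) into-S-s (suc-injective ∘₂ injective)))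
                              (x∈p⇒∣p-x∣<∣p∣ (into f0≡))
    where
    into-S-s : ∀ {c s′} → f (suc c) ≡ just s′ → s′ ∈ S - s
    into-S-s {c} fc≡ = x∈p∧x≢y⇒x∈p-y (into fc≡) λ { refl → 0≢1+n (injective f0≡ fc≡) }

  sum-updateAt : ∀ {A : Set} {n} (h : A → ℕ) (κ : Fin n → A) c x →
                 sum (h ∘ updateAt κ c (λ _ → x)) + h (κ c) ≡ sum (h ∘ κ) + h x
  sum-updateAt {n = suc n} h κ c x = begin
    sum (h ∘ κ′) + h (κ c)                        ≡⟨ cong (_+ h (κ c)) (sum-remove {i = c} (h ∘ κ′)) ⟩
    h (κ′ c) + sum (h ∘ κ′ ∘ punchIn c) + h (κ c)
      ≡⟨ cong₂ (λ y z → y + z + h (κ c)) (cong h (updateAt-updates c κ))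
                                         (sum-cong-≗ λ k → cong h (updateAt-minimal _ c κ (punchInᵢ≢i c k))) ⟩
    h x + sum (h ∘ κ ∘ punchIn c) + h (κ c)       ≡⟨ xy∙z≈zy∙x (h x) _ (h (κ c)) ⟩
    h (κ c) + sum (h ∘ κ ∘ punchIn c) + h x       ≡⟨ cong (_+ h x) (sum-remove {i = c} (h ∘ κ)) ⟨
    sum (h ∘ κ) + h x                             ∎
    where
    open ≡-Reasoning
    κ′ = updateAt κ c (λ _ → x)

  sum-ones : ∀ n → sum {n} (λ _ → 1) ≡ n
  sum-ones zero    = refl
  sum-ones (suc n) = cong suc (sum-ones n)

module LowRank where

  open import Data.Integer using (_+_; _*_)
  open import Data.Sum using (_⊎_; inj₁; inj₂)
  open import Data.Vec using ([]; _∷_; here; there)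
  open import Data.Vec.Functional using (Vector; _++_)
  open import Data.Vec.Functional.Properties using (lookup-++ˡ; lookup-++ʳ)
  open import Data.Fin using (splitAt; _↑ˡ_; _↑ʳ_)
  open import Data.Fin.Properties using (splitAt⁻¹-↑ˡ; splitAt⁻¹-↑ʳ)
  open import Data.Fin.Subset using (Subset; _∈_; _∉_; ∣_∣; ⊤; inside; outside)
  open import Data.Fin.Subset.Properties using (∈⊤; _∈?_)
  open import Relation.Nullary.Decidable using (dec-true; dec-false)
  open import Data.Bool using (if_then_else_)
  open import Algebra.Properties.Semiring.Sum ℤₚ.+-*-semiring
  open Determinant using (δ)
  open ≡-Reasoning
  import Data.Vec as Vec

  ∈-++⁺ˡ : ∀ {m n} {S : Subset m} {T : Subset n} {s} → s ∈ S → s ↑ˡ n ∈ S Vec.++ T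
  ∈-++⁺ˡ here        = here
  ∈-++⁺ˡ (there s∈S) = there (∈-++⁺ˡ s∈S)

  ∈-++⁺ʳ : ∀ {m n} (S : Subset m) {T : Subset n} {s} → s ∈ T → m ↑ʳ s ∈ S Vec.++ T
  ∈-++⁺ʳ []      s∈T = s∈T
  ∈-++⁺ʳ (_ ∷ S) s∈T = there (∈-++⁺ʳ S s∈T)

  ∣p++q∣≡∣p∣+∣q∣ : ∀ {m n} (S : Subset m) (T : Subset n) → ∣ S Vec.++ T ∣ ≡ ∣ S ∣ ℕ.+ ∣ T ∣
  ∣p++q∣≡∣p∣+∣q∣ []            T = refl
  ∣p++q∣≡∣p∣+∣q∣ (inside ∷ S)  T = cong suc (∣p++q∣≡∣p∣+∣q∣ S T)
  ∣p++q∣≡∣p∣+∣q∣ (outside ∷ S) T = ∣p++q∣≡∣p∣+∣q∣ S T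

  ∑-↑ : ∀ m {n} (f : Fin (m ℕ.+ n) → ℤ) →
        ∑[ s < m ℕ.+ n ] f s ≡ ∑[ i < m ] f (i ↑ˡ n) + ∑[ j < n ] f (m ↑ʳ j)
  ∑-↑ zero    f = sym (ℤₚ.+-identityˡ _)
  ∑-↑ (suc m) f = trans (cong (f zero +_) (∑-↑ m (f ∘ suc))) (sym (ℤₚ.+-assoc (f zero) _ _))

  ∑-δ : ∀ {n} (f : Fin n → ℤ) u → ∑[ s < n ] (δ s u * f s) ≡ f u
  ∑-δ {suc n} f u = begin
    ∑[ s < suc n ] (δ s u * f s)
      ≡⟨ sum-remove {i = u} (λ s → δ s u * f s) ⟩
    δ u u * f u + ∑[ k < n ] (δ (punchIn u k) u * f (punchIn u k))
      ≡⟨ cong₂ _+_ diagonal (trans (sum-cong-≗ off-diagonal) (sum-replicate-zero n)) ⟩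
    f u + 0ℤ
      ≡⟨ ℤₚ.+-identityʳ (f u) ⟩
    f u ∎
    where
    diagonal : δ u u * f u ≡ f u
    diagonal = trans (cong (λ b → (if b then 1ℤ else 0ℤ) * f u) (dec-true (u ≟ u) refl)) (ℤₚ.*-identityˡ (f u))
    off-diagonal : ∀ k → δ (punchIn u k) u * f (punchIn u k) ≡ 0ℤ
    off-diagonal k = cong (λ b → (if b then 1ℤ else 0ℤ) * f (punchIn u k)) (dec-false (punchIn u k ≟ u) (punchInᵢ≢i u k))

  zeros : ∀ {n} → Vector ℤ n
  zeros _ = 0ℤ

  ++-zero : ∀ {m n} {x : Vector ℤ m} {y : Vector ℤ n} →
            (∀ i → x i ≡ 0ℤ) → (∀ j → y j ≡ 0ℤ) → ∀ k → (x ++ y) k ≡ 0ℤ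
  ++-zero {m} x≡0 y≡0 k with splitAt m k
  ... | inj₁ i = x≡0 i
  ... | inj₂ j = y≡0 j

  VanishesOff : ∀ {N p} → Subset N → (Fin N → Fin p → ℤ) → Set
  VanishesOff S x = ∀ {s} → s ∉ S → ∀ u → x s u ≡ 0ℤ

  VanishesOff-++ : ∀ {m n p} {S : Subset m} {T : Subset n} {x : Fin m → Fin p → ℤ} {y : Fin n → Fin p → ℤ} →
                   VanishesOff S x → VanishesOff T y → VanishesOff (S Vec.++ T) (x ++ y)
  VanishesOff-++ {m} {S = S} x-vanishes y-vanishes {s} s∉ u with splitAt m s in eq
  ... | inj₁ i = x-vanishes (λ i∈S → s∉ (subst (_∈ _) (splitAt⁻¹-↑ˡ eq) (∈-++⁺ˡ i∈S))) u
  ... | inj₂ j = y-vanishes (λ j∈T → s∉ (subst (_∈ _) (splitAt⁻¹-↑ʳ eq) (∈-++⁺ʳ S j∈T))) u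

  -- A witness of rank B ≤ ∣ support ∣.
  record Factorization {p q : ℕ} (B : Fin p → Fin q → ℤ) : Set where
    field
      {size}         : ℕ
      support        : Subset size
      left           : Fin size → Fin p → ℤ
      right          : Fin size → Fin q → ℤ
      left-vanishes  : VanishesOff support left
      right-vanishes : VanishesOff support right
      factorizes     : ∀ u v → ∑[ s < size ] (left s u * right s v) ≡ B u v

  open Factorization public

  Factorization-cong : ∀ {p q} {B C : Fin p → Fin q → ℤ} →
                       (∀ u v → B u v ≡ C u v) → Factorization B → Factorization C
  Factorization-cong B≗C F = record
    { support        = support F
    ; left           = left F
    ; right          = right F
    ; left-vanishes  = left-vanishes F
    ; right-vanishes = right-vanishes F
    ; factorizes     = λ u v → trans (factorizes F u v) (B≗C u v)
    }

  transpose : ∀ {p q} {B : Fin p → Fin q → ℤ} → Factorization B → Factorization (λ v u → B u v)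
  transpose F = record
    { support        = support F
    ; left           = right F
    ; right          = left F
    ; left-vanishes  = right-vanishes F
    ; right-vanishes = left-vanishes F
    ; factorizes     = λ v u → trans (sum-cong-≗ λ s → ℤₚ.*-comm (right F s v) (left F s u)) (factorizes F u v)
    }

  scale : ∀ {p q} {B : Fin p → Fin q → ℤ} a → Factorization B → Factorization (λ u v → a * B u v)
  scale {B = B} a F = record
    { support        = support F
    ; left           = λ s u → a * left F s u
    ; right          = right F
    ; left-vanishes  = λ s∉ u → trans (cong (a *_) (left-vanishes F s∉ u)) (ℤₚ.*-zeroʳ a)
    ; right-vanishes = right-vanishes F
    ; factorizes     = λ u v → begin
        ∑[ s < size F ] (a * left F s u * right F s v)   ≡⟨ sum-cong-≗ (λ s → ℤₚ.*-assoc a (left F s u) (right F s v)) ⟩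
        ∑[ s < size F ] (a * (left F s u * right F s v)) ≡⟨ *-distribˡ-sum a (λ s → left F s u * right F s v) ⟨
        a * ∑[ s < size F ] (left F s u * right F s v)   ≡⟨ cong (a *_) (factorizes F u v) ⟩
        a * B u v                                       ∎
    }

  ones : ∀ {p q} → Factorization {p} {q} (λ _ _ → 1ℤ)
  ones = record
    { support        = ⊤ {1}
    ; left           = λ _ _ → 1ℤ
    ; right          = λ _ _ → 1ℤ
    ; left-vanishes  = λ s∉ → ⊥-elim (s∉ ∈⊤)
    ; right-vanishes = λ s∉ → ⊥-elim (s∉ ∈⊤)
    ; factorizes     = λ _ _ → refl
    }

  infixl 6 _⊕_

  _⊕_ : ∀ {p q} {B C : Fin p → Fin q → ℤ} →
        Factorization B → Factorization C → Factorization (λ u v → B u v + C u v)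
  F ⊕ G = record
    { support        = support F Vec.++ support G
    ; left           = left F ++ left G
    ; right          = right F ++ right G
    ; left-vanishes  = VanishesOff-++ (left-vanishes F) (left-vanishes G)
    ; right-vanishes = VanishesOff-++ (right-vanishes F) (right-vanishes G)
    ; factorizes     = λ u v → trans (∑-↑ (size F) _) (cong₂ _+_
        (trans (sum-cong-≗ λ s → cong₂ (λ l r → l u * r v) (lookup-++ˡ (left F) (left G) s)
                                                            (lookup-++ˡ (right F) (right G) s))
               (factorizes F u v))
        (trans (sum-cong-≗ λ s → cong₂ (λ l r → l u * r v) (lookup-++ʳ (left F) (left G) s)
                                                            (lookup-++ʳ (right F) (right G) s))
               (factorizes G u v)))
    }

  upperRight : ∀ {p q} → (Fin p → Fin q → ℤ) → Fin (p ℕ.+ q) → Fin (p ℕ.+ q) → ℤ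
  upperRight {p} {q} B i j = corner (splitAt p i) (splitAt p j)
    where
    corner : Fin p ⊎ Fin q → Fin p ⊎ Fin q → ℤ
    corner (inj₁ u) (inj₂ v) = B u v
    corner _        _        = 0ℤ

  upperRight-factorization : ∀ {p q} {B : Fin p → Fin q → ℤ} → Factorization B → Factorization (upperRight B)
  upperRight-factorization {p} {B = B} F = record
    { support        = support F
    ; left           = λ s → left F s ++ zeros
    ; right          = λ s → zeros ++ right F s
    ; left-vanishes  = λ s∉ → ++-zero (left-vanishes F s∉) (λ _ → refl)
    ; right-vanishes = λ s∉ → ++-zero (λ _ → refl) (right-vanishes F s∉)
    ; factorizes     = factorizes′
    }
    where
    factorizes′ : ∀ i j → ∑[ s < size F ] ((left F s ++ zeros) i * (zeros ++ right F s) j) ≡ upperRight B i j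
    factorizes′ i j with splitAt p i | splitAt p j
    ... | inj₁ u | inj₁ _ = trans (sum-cong-≗ λ s → ℤₚ.*-zeroʳ (left F s u)) (sum-replicate-zero (size F))
    ... | inj₁ u | inj₂ v = factorizes F u v
    ... | inj₂ _ | _      = sum-replicate-zero (size F)

  bipartite : ∀ {p q} {B : Fin p → Fin q → ℤ} → Factorization B →
              Factorization (λ i j → upperRight B i j + upperRight B j i)
  bipartite F = upperRight-factorization F ⊕ transpose (upperRight-factorization F)

  rows : ∀ {p q} (U : Subset p) {B : Fin p → Fin q → ℤ} → VanishesOff U B → Factorization B
  rows U {B} zero-rows = record
    { support        = U
    ; left           = restrictedδ
    ; right          = B
    ; left-vanishes  = λ {s} s∉ u → cong (λ b → if b then δ s u else 0ℤ) (dec-false (s ∈? U) s∉)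
    ; right-vanishes = zero-rows
    ; factorizes     = λ u v → trans (sum-cong-≗ λ s → restrictedδ≈δ s u v) (∑-δ (λ s → B s v) u)
    }
    where
    restrictedδ : Fin _ → Fin _ → ℤ
    restrictedδ s u = if does (s ∈? U) then δ s u else 0ℤ
    restrictedδ≈δ : ∀ s u v → restrictedδ s u * B s v ≡ δ s u * B s v
    restrictedδ≈δ s u v with s ∈? U
    ... | yes _  = refl
    ... | no  s∉ = sym (trans (cong (δ s u *_) (zero-rows s∉ v)) (ℤₚ.*-zeroʳ (δ s u)))

  columns : ∀ {p q} (V : Subset q) {B : Fin p → Fin q → ℤ} → VanishesOff V (λ v u → B u v) → Factorization B
  columns V zero-columns = transpose (rows V zero-columns)

module RankBound where

  open import Data.Integer using (_+_; _*_; -_)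
  open import Data.Integer.Divisibility.Signed using (_∣_; divides; ∣m∣n⇒∣m+n; ∣n⇒∣m*n; *-monoʳ-∣; ∣-trans)
  open import Data.Maybe using (Maybe; just; nothing)
  open import Data.Fin.Subset using (_∈_; ∣_∣)
  open import Data.Fin.Subset.Properties using (_∈?_)
  open import Data.List using (List; []; _∷_; allFin)
  open import Data.List.Membership.Propositional using () renaming (_∈_ to _∈ᴸ_)
  open import Data.List.Membership.Propositional.Properties using (∈-allFin)
  open import Data.List.Relation.Unary.Any using (here; there)
  open import Data.List.Relation.Unary.Any.Properties using (¬Any[])
  open import Algebra.Properties.Semiring.Sum ℤₚ.+-*-semiring
  import Algebra.Properties.Semiring.Sum as Sum
  module ℕΣ = Sum ℕₚ.+-*-semiring
  open Determinant
  open Counting using (defined; sum-defined-≤; sum-updateAt; sum-ones)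
  open CharacteristicPolynomial using (mult0-≥)
  open LowRank
  open ≡-Reasoning

  ∣0 : ∀ k → k ∣ 0ℤ
  ∣0 k = divides 0ℤ refl

  1∣ : ∀ x → 1ℤ ∣ x
  1∣ x = divides x (sym (ℤₚ.*-identityʳ x))

  ∣-∑ : ∀ {k} n (f : Fin n → ℤ) → (∀ i → k ∣ f i) → k ∣ ∑[ i < n ] f i
  ∣-∑ zero    f _       = ∣0 _
  ∣-∑ (suc n) f k∣f = ∣m∣n⇒∣m+n (k∣f zero) (∣-∑ n (f ∘ suc) (k∣f ∘ suc))

  ^-∣-mono : ∀ t {d e} → d ≤ e → t ^ d ∣ t ^ e
  ^-∣-mono t {d} {e} d≤e = divides (t ^ (e ∸ d)) (begin
    t ^ e                ≡⟨ cong (t ^_) (ℕₚ.m∸n+n≡m d≤e) ⟨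
    t ^ (e ∸ d ℕ.+ d)    ≡⟨ ℤₚ.^-distribˡ-+-* t (e ∸ d) d ⟩
    t ^ (e ∸ d) * t ^ d  ∎)

  suc-∸-≤ : ∀ a m → suc a ∸ m ≤ suc (a ∸ m)
  suc-∸-≤ a m = ℕₚ.m≤n+o⇒m∸n≤o (suc a) m
    (subst (suc a ≤_) (sym (ℕₚ.+-suc m (a ∸ m))) (s≤s (ℕₚ.m≤n+m∸n a m)))

  -- The shape of a column c in the multilinear expansion of det (tI + B): full is t e_c plus
  -- column c of B, unit is e_c (its factor t already taken out), basis s is the vector left s.
  data Column (N : ℕ) : Set where
    full unit : Column N
    basis     : Fin N → Column N

  weight : ∀ {N} → Column N → ℕ
  weight full      = 1
  weight unit      = 0
  weight (basis _) = 1

  full? : ∀ {N} (x : Column N) → Dec (x ≡ full)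
  full? full      = yes refl
  full? unit      = no λ ()
  full? (basis _) = no λ ()

  basisIndex : ∀ {N} → Column N → Maybe (Fin N)
  basisIndex (basis s) = just s
  basisIndex full      = nothing
  basisIndex unit      = nothing

  basisIndex-just : ∀ {N} (x : Column N) {s} → basisIndex x ≡ just s → x ≡ basis s
  basisIndex-just (basis s) refl = refl

  weight-basisIndex : ∀ {N} (x : Column N) → x ≢ full → weight x ≡ defined (basisIndex x)
  weight-basisIndex full      x≢full = ⊥-elim (x≢full refl)
  weight-basisIndex unit      _      = refl
  weight-basisIndex (basis _) _      = refl

  module Expansion {n} {B : Matrix n} (F : Factorization B) (t : ℤ) where

    column : Column (size F) → Fin n → Fin n → ℤ
    column full      c i = t * δ i c + ∑[ s < size F ] (right F s c * left F s i)
    column unit      c i = δ i c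
    column (basis s) c i = left F s i

    matrix : (Fin n → Column (size F)) → Matrix n
    matrix κ i c = column (κ c) c i

    exponent : (Fin n → Column (size F)) → ℕ
    exponent κ = ℕΣ.sum (weight ∘ κ) ∸ ∣ support F ∣

    _[_≔_] : (Fin n → Column (size F)) → Fin n → Column (size F) → Fin n → Column (size F)
    κ [ c ≔ x ] = updateAt κ c (λ _ → x)

    matrix-update : ∀ κ c x i j → matrix (κ [ c ≔ x ]) i j ≡ setColumn (matrix κ) c (λ i → column x c i) i j
    matrix-update κ c x i j with j ≟ c
    ... | yes refl = trans (cong (λ y → column y j i) (updateAt-updates j κ))
                           (sym (setColumn-updates (matrix κ) j (λ i → column x j i) i))
    ... | no j≢c   = trans (cong (λ y → column y j i) (updateAt-minimal j c κ j≢c))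
                           (sym (setColumn-minimal (matrix κ) (λ i → column x c i) i j≢c))

    expand-full-column : ∀ κ c → κ c ≡ full →
      detℤ n (matrix κ) ≡ t * detℤ n (matrix (κ [ c ≔ unit ]))
                          + ∑[ s < size F ] (right F s c * detℤ n (matrix (κ [ c ≔ basis s ])))
    expand-full-column κ c κc≡full = begin
      detℤ n (matrix κ)
        ≡⟨ detℤ-cong n (setColumn-unchanged (matrix κ) λ i → cong (λ y → column y c i) (sym κc≡full)) ⟨
      detℤ n (setColumn (matrix κ) c (λ i → ∑[ k < suc (size F) ] (coefficient k * column (choice k) c i)))
        ≡⟨ detℤ-setColumn-∑ n (matrix κ) c coefficient (λ k i → column (choice k) c i) ⟩
      ∑[ k < suc (size F) ] (coefficient k * detℤ n (setColumn (matrix κ) c (λ i → column (choice k) c i)))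
        ≡⟨ sum-cong-≗ (λ k → cong (coefficient k *_) (detℤ-cong n λ i j → sym (matrix-update κ c (choice k) i j))) ⟩
      ∑[ k < suc (size F) ] (coefficient k * detℤ n (matrix (κ [ c ≔ choice k ])))  ∎
      where
      coefficient : Fin (suc (size F)) → ℤ
      coefficient zero    = t
      coefficient (suc s) = right F s c
      choice : Fin (suc (size F)) → Column (size F)
      choice zero    = unit
      choice (suc s) = basis s

    -- A nonzero determinant has neither a zero nor a repeated column, so its basis columns are
    -- distinct elements of the support.
    divides-without-full-columns : ∀ κ → (∀ c → κ c ≢ full) → t ^ exponent κ ∣ detℤ n (matrix κ)
    divides-without-full-columns κ no-full with detℤ n (matrix κ) ℤₚ.≟ 0ℤ
    ... | yes det≡0 = subst (t ^ exponent κ ∣_) (sym det≡0) (∣0 _)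
    ... | no  det≢0 = subst (λ e → t ^ e ∣ detℤ n (matrix κ)) (sym (ℕₚ.m≤n⇒m∸n≡0 weight≤support)) (1∣ _)
      where
      column≡left : ∀ {c s} → basisIndex (κ c) ≡ just s → ∀ i → matrix κ i c ≡ left F s i
      column≡left {c} eq i = cong (λ y → column y c i) (basisIndex-just (κ c) eq)
      into-support : ∀ {c s} → basisIndex (κ c) ≡ just s → s ∈ support F
      into-support {c} {s} eq with s ∈? support F
      ... | yes s∈S = s∈S
      ... | no  s∉S = ⊥-elim (det≢0 (detℤ-zero-column n (matrix κ) c λ i →
                                       trans (column≡left eq i) (left-vanishes F s∉S i)))
      injective : ∀ {c c′ s} → basisIndex (κ c) ≡ just s → basisIndex (κ c′) ≡ just s → c ≡ c′
      injective {c} {c′} eq eq′ with c ≟ c′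
      ... | yes c≡c′ = c≡c′
      ... | no  c≢c′ = ⊥-elim (det≢0 (detℤ-equal-columns n (matrix κ) c≢c′ λ i →
                                        trans (column≡left eq i) (sym (column≡left eq′ i))))
      weight≤support : ℕΣ.sum (weight ∘ κ) ≤ ∣ support F ∣
      weight≤support = subst (_≤ ∣ support F ∣) (ℕΣ.sum-cong-≗ λ c → sym (weight-basisIndex (κ c) (no-full c)))
                             (sum-defined-≤ (basisIndex ∘ κ) (support F) into-support injective)

    FullColumnsIn : (Fin n → Column (size F)) → List (Fin n) → Set
    FullColumnsIn κ pending = ∀ {c} → κ c ≡ full → c ∈ᴸ pending

    FullColumnsIn-update : ∀ {κ c x pending} → x ≢ full →
                           FullColumnsIn κ (c ∷ pending) → FullColumnsIn (κ [ c ≔ x ]) pending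
    FullColumnsIn-update {κ} {c} {x} x≢full full⊆ {c′} κ′c′≡full with c′ ≟ c
    ... | yes refl = ⊥-elim (x≢full (trans (sym (updateAt-updates c′ κ)) κ′c′≡full))
    ... | no  c′≢c with full⊆ (trans (sym (updateAt-minimal c′ c κ c′≢c)) κ′c′≡full)
    ...   | here c′≡c  = ⊥-elim (c′≢c c′≡c)
    ...   | there c′∈ = c′∈

    FullColumnsIn-skip : ∀ {κ c pending} → κ c ≢ full → FullColumnsIn κ (c ∷ pending) → FullColumnsIn κ pending
    FullColumnsIn-skip κc≢full full⊆ κc′≡full with full⊆ κc′≡full
    ... | here refl = ⊥-elim (κc≢full κc′≡full)
    ... | there c′∈ = c′∈

    divides-det : ∀ pending κ → FullColumnsIn κ pending → t ^ exponent κ ∣ detℤ n (matrix κ)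
    divides-det []            κ full⊆ = divides-without-full-columns κ λ c κc≡full → ¬Any[] (full⊆ κc≡full)
    divides-det (c ∷ pending) κ full⊆ with full? (κ c)
    ... | no  κc≢full = divides-det pending κ (FullColumnsIn-skip κc≢full full⊆)
    ... | yes κc≡full =
      subst (t ^ exponent κ ∣_) (sym (expand-full-column κ c κc≡full)) (∣m∣n⇒∣m+n unit-term basis-terms)
      where
      weights : ∀ x → ℕΣ.sum (weight ∘ κ [ c ≔ x ]) ℕ.+ 1 ≡ ℕΣ.sum (weight ∘ κ) ℕ.+ weight x
      weights x = trans (cong (λ y → ℕΣ.sum (weight ∘ κ [ c ≔ x ]) ℕ.+ weight y) (sym κc≡full))
                        (sum-updateAt weight κ c x)
      unit-exponent : exponent κ ≤ suc (exponent (κ [ c ≔ unit ]))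
      unit-exponent = subst (λ w → w ∸ ∣ support F ∣ ≤ suc (exponent (κ [ c ≔ unit ])))
                            (trans (ℕₚ.+-comm 1 _) (trans (weights unit) (ℕₚ.+-identityʳ _)))
                            (suc-∸-≤ (ℕΣ.sum (weight ∘ κ [ c ≔ unit ])) ∣ support F ∣)
      basis-exponent : ∀ s → exponent (κ [ c ≔ basis s ]) ≡ exponent κ
      basis-exponent s = cong (_∸ ∣ support F ∣) (ℕₚ.+-cancelʳ-≡ 1 _ _ (weights (basis s)))
      unit-term : t ^ exponent κ ∣ t * detℤ n (matrix (κ [ c ≔ unit ]))
      unit-term = ∣-trans (^-∣-mono t unit-exponent)
                          (*-monoʳ-∣ t (divides-det pending (κ [ c ≔ unit ]) (FullColumnsIn-update (λ ()) full⊆)))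
      basis-terms : t ^ exponent κ ∣ ∑[ s < size F ] (right F s c * detℤ n (matrix (κ [ c ≔ basis s ])))
      basis-terms = ∣-∑ (size F) _ λ s → ∣n⇒∣m*n (right F s c)
        (subst (λ e → t ^ e ∣ detℤ n (matrix (κ [ c ≔ basis s ]))) (basis-exponent s)
               (divides-det pending (κ [ c ≔ basis s ]) (FullColumnsIn-update (λ ()) full⊆)))

  rank-bound : ∀ {n} {B : Matrix n} (F : Factorization B) t →
               t ^ (n ∸ ∣ support F ∣) ∣ detℤ n (λ i j → t * δ i j + B i j)
  rank-bound {n} {B} F t =
    subst₂ (λ e d → t ^ e ∣ d) (cong (_∸ ∣ support F ∣) (sum-ones n)) (detℤ-cong n all-full≡)
           (divides-det (allFin n) (λ _ → full) (λ {c} _ → ∈-allFin c))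
    where
    open Expansion F t
    all-full≡ : ∀ i j → matrix (λ _ → full) i j ≡ t * δ i j + B i j
    all-full≡ i j = cong (t * δ i j +_)
      (trans (sum-cong-≗ λ s → ℤₚ.*-comm (right F s j) (left F s i)) (factorizes F i j))

  mult0-≥-n∸rank : ∀ n (A : Matrix n) (F : Factorization (λ i j → - A i j)) → n ∸ ∣ support F ∣ ≤ mult0 n A
  mult0-≥-n∸rank n A F =
    mult0-≥ n A (n ∸ ∣ support F ∣) (ℕₚ.m∸n≤m n ∣ support F ∣) (λ s → rank-bound F +[1+ s ])

module SignedCompleteBipartite where

  open import Data.Integer using (_+_; _*_; -_)
  open import Data.Bool using (Bool; true; false)
  open import Data.Sum using (inj₁; inj₂)
  open import Data.Fin using (splitAt)
  open import Data.Fin.Subset using (Subset; _∈_; ∣_∣; ⊤)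
  open import Data.Product using (Σ-syntax; proj₁; proj₂)
  open import Data.Nat.Tactic.RingSolver using () renaming (solve-∀ to ℕ-solve-∀)
  import Data.Vec as Vec
  open LowRank

  indicator : Bool → ℤ
  indicator true  = 1ℤ
  indicator false = 0ℤ

  positiveEdges : ∀ {p q} → SignedKpq p q → Fin p → Fin q → ℤ
  positiveEdges σ u v = indicator (σ u v)

  -2ℤ : ℤ
  -2ℤ = -[1+ 1 ]

  neg-signℤ : ∀ b → - signℤ b ≡ 1ℤ + -2ℤ * indicator b
  neg-signℤ true  = refl
  neg-signℤ false = refl

  neg-adjKpq : ∀ p q σ i j → - adjKpq p q σ i j ≡ upperRight (λ u v → 1ℤ + -2ℤ * positiveEdges σ u v) i j
                                                   + upperRight (λ u v → 1ℤ + -2ℤ * positiveEdges σ u v) j i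
  neg-adjKpq p q σ i j with splitAt p i | splitAt p j
  ... | inj₁ u | inj₁ _ = refl
  ... | inj₁ u | inj₂ v = trans (neg-signℤ (σ u v)) (sym (ℤₚ.+-identityʳ _))
  ... | inj₂ v | inj₁ u = trans (neg-signℤ (σ u v)) (sym (ℤₚ.+-identityˡ _))
  ... | inj₂ _ | inj₂ _ = refl

  Covers : ∀ {p q} → SignedKpq p q → Subset p → Subset q → Set
  Covers {p} {q} σ U V = ∀ (u : Fin p) (v : Fin q) → σ u v ≡ true → u ∈ U × v ∈ V

  positiveEdges-vanish-off-rows : ∀ {p q} (σ : SignedKpq p q) {U V} → Covers σ U V → VanishesOff U (positiveEdges σ)
  positiveEdges-vanish-off-rows σ covers {u} u∉U v with σ u v in σuv≡
  ... | true  = ⊥-elim (u∉U (proj₁ (covers u v σuv≡)))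
  ... | false = refl

  positiveEdges-vanish-off-columns : ∀ {p q} (σ : SignedKpq p q) {U V} → Covers σ U V →
                                     VanishesOff V (λ v u → positiveEdges σ u v)
  positiveEdges-vanish-off-columns σ covers {v} v∉V u with σ u v in σuv≡
  ... | true  = ⊥-elim (v∉V (proj₂ (covers u v σuv≡)))
  ... | false = refl

  positiveEdges-factorization : ∀ {p q} (σ : SignedKpq p q) {U V} → Covers σ U V →
                                Σ[ F ∈ Factorization (positiveEdges σ) ] ∣ support F ∣ ≡ ∣ U ∣ ⊓ ∣ V ∣
  positiveEdges-factorization σ {U} {V} covers with ℕₚ.≤-total ∣ U ∣ ∣ V ∣
  ... | inj₁ U≤V = rows U (positiveEdges-vanish-off-rows σ covers) , sym (ℕₚ.m≤n⇒m⊓n≡m U≤V)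
  ... | inj₂ V≤U = columns V (positiveEdges-vanish-off-columns σ covers) , sym (ℕₚ.m≥n⇒m⊓n≡n V≤U)

  adjacency-factorization : ∀ {p q} (σ : SignedKpq p q) {U V} → Covers σ U V →
    Σ[ F ∈ Factorization (λ i j → - adjKpq p q σ i j) ] ∣ support F ∣ ≡ 2 ℕ.* (∣ U ∣ ⊓ ∣ V ∣) ℕ.+ 2
  adjacency-factorization {p} {q} σ covers with F , size≡ ← positiveEdges-factorization σ covers =
    Factorization-cong (λ i j → sym (neg-adjKpq p q σ i j)) (bipartite (ones ⊕ scale -2ℤ F)) ,
    trans (∣p++q∣≡∣p∣+∣q∣ (⊤ {1} Vec.++ support F) (⊤ {1} Vec.++ support F))
          (trans (cong (λ k → suc k ℕ.+ suc k) size≡) (double-suc _))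
    where
    double-suc : ∀ k → suc k ℕ.+ suc k ≡ 2 ℕ.* k ℕ.+ 2
    double-suc = ℕ-solve-∀

open import Data.Nat using (_+_; _*_)
open import Data.Bool using (true)
open import Data.Fin.Subset using (Subset; _∈_; ∣_∣)
open LowRank using (support)
open RankBound using (mult0-≥-n∸rank)
open SignedCompleteBipartite using (adjacency-factorization)

corollary3p2 : (p q : ℕ) → p ≤ q → (σ : SignedKpq p q)
    → (Ur : Subset p) (Vs : Subset q)
    → (∀ (u : Fin p) (v : Fin q) → σ u v ≡ true → u ∈ Ur × v ∈ Vs)
    → (∀ (U' : Subset p) (V' : Subset q)
         → (∀ (u : Fin p) (v : Fin q) → σ u v ≡ true → u ∈ U' × v ∈ V')
         → ∣ Ur ∣ + ∣ Vs ∣ ≤ ∣ U' ∣ + ∣ V' ∣)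
    → p + q ∸ 2 * (∣ Ur ∣ ⊓ ∣ Vs ∣) ∸ 2 ≤ mult0 (p + q) (adjKpq p q σ)
corollary3p2 p q _ σ Ur Vs covers _ with F , size≡ ← adjacency-factorization σ covers = begin
  p + q ∸ 2 * (∣ Ur ∣ ⊓ ∣ Vs ∣) ∸ 2     ≡⟨ ℕₚ.∸-+-assoc (p + q) (2 * (∣ Ur ∣ ⊓ ∣ Vs ∣)) 2 ⟩
  p + q ∸ (2 * (∣ Ur ∣ ⊓ ∣ Vs ∣) + 2)   ≡⟨ cong (p + q ∸_) size≡ ⟨
  p + q ∸ ∣ support F ∣                  ≤⟨ mult0-≥-n∸rank (p + q) (adjKpq p q σ) F ⟩
  mult0 (p + q) (adjKpq p q σ)           ∎
  where open ℕₚ.≤-Reasoning
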